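{- If a System F type $A$ has no free type-variables, then $\mathrm{ver}_A(\mathrm{gen}_A)\twoheadrightarrow_w\star$ in $\lambda^{\mathsf F}_{\mathfrak m}$.
   Context: Types: $A,B ::= a \mid \mathbf{a} \mid A\Rightarrow B \mid \forall a.A$ with disjoint sets of type-variables $a$ and eigenvariables $\mathbf{a}$ ($\forall a$ binds $a$; eigenvariables are never bound in types). Metaterms of $\lambda^{\mathsf F}_{\mathfrak m}$: $M,N ::= x \mid \lambda x.M \mid M\,N \mid \Lambda a.M \mid M\,A \mid \star \mid (M\triangleright N) \mid \mathrm{gen}_A \mid \mathrm{ver}_A(M) \mid \nu\mathbf{a}.M$. Weak head reduction $\to_w$ is the closure under weak head contexts $W ::= \Box \mid W\,M \mid W\,A \mid (W\triangleright M) \mid \mathrm{ver}_A(W) \mid \nu\mathbf{a}.W$ of the rules: (1) $(\lambda x.M)N\to M\{x:=N\}$; (2) $(\Lambda a.M)A\to M\{a:=A\}$; (3) $(\star\triangleright M)\to M$; (4) $\mathrm{ver}_{\mathbf{a}}(\mathrm{gen}_{\mathbf{a}})\to\star$ for eigenvariables $\mathbf{a}$; (5) $\mathrm{gen}_{A\Rightarrow B}\to\lambda x.(\mathrm{ver}_A(x)\triangleright\mathrm{gen}_B)$; (6) $\mathrm{ver}_{A\Rightarrow B}(M)\to\mathrm{ver}_B(M\,\mathrm{gen}_A)$; (7) $\mathrm{gen}_{\forall a.A}\to\Lambda a.\mathrm{gen}_A$; (8) $\mathrm{ver}_{\forall a.A}(M)\to\nu\mathbf{a}.\mathrm{ver}_{A\{a:=\mathbf{a}\}}(M\,\mathbf{a})$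 with $\mathbf{a}$ fresh; (9) $\nu\mathbf{a}.M\to M$ if $\mathbf{a}$ not free in $M$. $\twoheadrightarrow_w$ is the reflexive-transitive closure of $\to_w$. -}

module Defs where

open import Data.Nat using (ℕ; zero; suc; _<_)
open import Data.Product using (_×_)
open import Data.Unit using (⊤)
open import Function using (_∘_)
open import Relation.Binary.Construct.Closure.ReflexiveTransitive using (Star)

-- Locally de Bruijn presentation (alpha-equivalence built in).
-- Eigenvariables 𝐚   : de Bruijn indices  ev n, bound ONLY by ν in metaterms
--                      (never bound in types; ∀' does not bind them).

infixr 7 _⇒_
data Ty : Set where
  tv  : ℕ → Ty
  ev  : ℕ → Ty
  _⇒_ : Ty → Ty → Ty
  ∀'  : Ty → Ty

data Tm : Set where
  var  : ℕ → Tm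
  lam  : Tm → Tm
  app  : Tm → Tm → Tm
  Lam  : Tm → Tm
  tapp : Tm → Ty → Tm
  star : Tm
  tri  : Tm → Tm → Tm
  gen  : Ty → Tm
  ver  : Ty → Tm → Tm
  nu   : Tm → Tm

tvBelow : ℕ → Ty → Set
tvBelow k (tv n)  = n < k
tvBelow k (ev _)  = ⊤
tvBelow k (A ⇒ B) = tvBelow k A × tvBelow k B
tvBelow k (∀' A)  = tvBelow (suc k) A

TvClosed : Ty → Set
TvClosed = tvBelow 0

ext : (ℕ → ℕ) → ℕ → ℕ
ext ρ zero    = zero
ext ρ (suc n) = suc (ρ n)

renTv : (ℕ → ℕ) → Ty → Ty
renTv ρ (tv n)  = tv (ρ n)
renTv ρ (ev n)  = ev n
renTv ρ (A ⇒ B) = renTv ρ A ⇒ renTv ρ B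
renTv ρ (∀' A)  = ∀' (renTv (ext ρ) A)

renEv : (ℕ → ℕ) → Ty → Ty
renEv ρ (tv n)  = tv n
renEv ρ (ev n)  = ev (ρ n)
renEv ρ (A ⇒ B) = renEv ρ A ⇒ renEv ρ B
renEv ρ (∀' A)  = ∀' (renEv ρ A)

extTv : (ℕ → Ty) → ℕ → Ty
extTv σ zero    = tv zero
extTv σ (suc n) = renTv suc (σ n)

subTv : (ℕ → Ty) → Ty → Ty
subTv σ (tv n)  = σ n
subTv σ (ev n)  = ev n
subTv σ (A ⇒ B) = subTv σ A ⇒ subTv σ B
subTv σ (∀' A)  = ∀' (subTv (extTv σ) A)

-- substitution of type variable 0 by B (indices above 0 decremented)
single : {X : Set} → X → (ℕ → X) → ℕ → X
single x f zero    = x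
single x f (suc n) = f n

_[_]ᵀ : Ty → Ty → Ty
A [ B ]ᵀ = subTv (single B tv) A

renTvTm : (ℕ → ℕ) → Tm → Tm
renTvTm ρ (var x)    = var x
renTvTm ρ (lam M)    = lam (renTvTm ρ M)
renTvTm ρ (app M N)  = app (renTvTm ρ M) (renTvTm ρ N)
renTvTm ρ (Lam M)    = Lam (renTvTm (ext ρ) M)
renTvTm ρ (tapp M A) = tapp (renTvTm ρ M) (renTv ρ A)
renTvTm ρ star       = star
renTvTm ρ (tri M N)  = tri (renTvTm ρ M) (renTvTm ρ N)
renTvTm ρ (gen A)    = gen (renTv ρ A)
renTvTm ρ (ver A M)  = ver (renTv ρ A) (renTvTm ρ M)
renTvTm ρ (nu M)     = nu (renTvTm ρ M)

renEvTm : (ℕ → ℕ) → Tm → Tm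
renEvTm ρ (var x)    = var x
renEvTm ρ (lam M)    = lam (renEvTm ρ M)
renEvTm ρ (app M N)  = app (renEvTm ρ M) (renEvTm ρ N)
renEvTm ρ (Lam M)    = Lam (renEvTm ρ M)
renEvTm ρ (tapp M A) = tapp (renEvTm ρ M) (renEv ρ A)
renEvTm ρ star       = star
renEvTm ρ (tri M N)  = tri (renEvTm ρ M) (renEvTm ρ N)
renEvTm ρ (gen A)    = gen (renEv ρ A)
renEvTm ρ (ver A M)  = ver (renEv ρ A) (renEvTm ρ M)
renEvTm ρ (nu M)     = nu (renEvTm (ext ρ) M)

subTvTm : (ℕ → Ty) → Tm → Tm
subTvTm σ (var x)    = var x
subTvTm σ (lam M)    = lam (subTvTm σ M)
subTvTm σ (app M N)  = app (subTvTm σ M) (subTvTm σ N)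
subTvTm σ (Lam M)    = Lam (subTvTm (extTv σ) M)
subTvTm σ (tapp M A) = tapp (subTvTm σ M) (subTv σ A)
subTvTm σ star       = star
subTvTm σ (tri M N)  = tri (subTvTm σ M) (subTvTm σ N)
subTvTm σ (gen A)    = gen (subTv σ A)
subTvTm σ (ver A M)  = ver (subTv σ A) (subTvTm σ M)
subTvTm σ (nu M)     = nu (subTvTm (renEv suc ∘ σ) M)

renTm : (ℕ → ℕ) → Tm → Tm
renTm ρ (var x)    = var (ρ x)
renTm ρ (lam M)    = lam (renTm (ext ρ) M)
renTm ρ (app M N)  = app (renTm ρ M) (renTm ρ N)
renTm ρ (Lam M)    = Lam (renTm ρ M)
renTm ρ (tapp M A) = tapp (renTm ρ M) A
renTm ρ star       = star
renTm ρ (tri M N)  = tri (renTm ρ M) (renTm ρ N)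
renTm ρ (gen A)    = gen A
renTm ρ (ver A M)  = ver A (renTm ρ M)
renTm ρ (nu M)     = nu (renTm ρ M)

extTm : (ℕ → Tm) → ℕ → Tm
extTm σ zero    = var zero
extTm σ (suc n) = renTm suc (σ n)

subTm : (ℕ → Tm) → Tm → Tm
subTm σ (var x)    = σ x
subTm σ (lam M)    = lam (subTm (extTm σ) M)
subTm σ (app M N)  = app (subTm σ M) (subTm σ N)
subTm σ (Lam M)    = Lam (subTm (renTvTm suc ∘ σ) M)
subTm σ (tapp M A) = tapp (subTm σ M) A
subTm σ star       = star
subTm σ (tri M N)  = tri (subTm σ M) (subTm σ N)
subTm σ (gen A)    = gen A
subTm σ (ver A M)  = ver A (subTm σ M)
subTm σ (nu M)     = nu (subTm (renEvTm suc ∘ σ) M)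

_[_] : Tm → Tm → Tm
M [ N ] = subTm (single N var) M

_[_]ᵗ : Tm → Ty → Tm
M [ A ]ᵗ = subTvTm (single A tv) M

infix 4 _→w_
data _→w_ : Tm → Tm → Set where
  β     : ∀ {M N} → app (lam M) N →w M [ N ]
  βT    : ∀ {M A} → tapp (Lam M) A →w M [ A ]ᵗ
  tri⋆  : ∀ {M} → tri star M →w M
  verEv : ∀ {n} → ver (ev n) (gen (ev n)) →w star
  gen⇒  : ∀ {A B} → gen (A ⇒ B) →w lam (tri (ver A (var zero)) (gen B))
  ver⇒  : ∀ {A B M} → ver (A ⇒ B) M →w ver B (app M (gen A))
  gen∀  : ∀ {A} → gen (∀' A) →w Lam (gen A)
  -- (8) ver_{∀a.A}(M) → ν𝐚.ver_{A{a:=𝐚}}(M 𝐚),  𝐚 fresh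
  --     (the fresh 𝐚 is the ν-bound eigenvariable index 0; A and M are
  --      shifted so that their free eigenvariables avoid it)
  ver∀  : ∀ {A M} → ver (∀' A) M →w
          nu (ver ((renEv suc A) [ ev zero ]ᵀ) (tapp (renEvTm suc M) (ev zero)))
  -- (9) ν𝐚.M → M  if 𝐚 not free in M  (i.e. M is the shift of some N)
  νgc   : ∀ {N} → nu (renEvTm suc N) →w N
  appW  : ∀ {M M' N} → M →w M' → app M N →w app M' N
  tappW : ∀ {M M' A} → M →w M' → tapp M A →w tapp M' A
  triW  : ∀ {M M' N} → M →w M' → tri M N →w tri M' N
  verW  : ∀ {A M M'} → M →w M' → ver A M →w ver A M'
  nuW   : ∀ {M M'} → M →w M' → nu M →w nu M'

infix 4 _↠w_
_↠w_ : Tm → Tm → Set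
_↠w_ = Star _→w_

-- Induction on the size of A. For A ⇒ B the term ver_{A⇒B}(gen_{A⇒B}) reduces to
-- ver_B(ver_A(gen_A) ▷ gen_B), and for ∀a.A it reduces to ν𝐚.ver_C(gen_C) with
-- C = A{a:=𝐚}. Instantiating a bound variable by an eigenvariable preserves both
-- the size and the absence of free type variables, so the induction hypothesis
-- applies to C; the final ν𝐚.⋆ is collected by rule (9).
module Submission where

open import Defs
open import Data.Nat using (ℕ; zero; suc; _+_; _<_; z≤n; s≤s)
open import Data.Nat.Induction using (<-wellFounded)
open import Data.Nat.Properties using (m≤m+n; m≤n+m; ≤-reflexive)
open import Data.Product using (_,_)
open import Data.Unit using (tt)
open import Function using (_on_)
open import Induction.WellFounded using (WellFounded; Acc; acc)
open import Relation.Binary.Construct.On using (wellFounded)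
open import Relation.Binary.PropositionalEquality
  using (_≡_; refl; cong; cong₂; trans)
open import Relation.Binary.Construct.Closure.ReflexiveTransitive
  using (ε; _◅_; _◅◅_; gmap)

size : Ty → ℕ
size (tv _)  = 1
size (ev _)  = 1
size (A ⇒ B) = suc (size A + size B)
size (∀' A)  = suc (size A)

size-renEv : ∀ ρ A → size (renEv ρ A) ≡ size A
size-renEv ρ (tv n)  = refl
size-renEv ρ (ev n)  = refl
size-renEv ρ (A ⇒ B) = cong suc (cong₂ _+_ (size-renEv ρ A) (size-renEv ρ B))
size-renEv ρ (∀' A)  = cong suc (size-renEv ρ A)

size-renTv : ∀ ρ A → size (renTv ρ A) ≡ size A
size-renTv ρ (tv n)  = refl
size-renTv ρ (ev n)  = refl
size-renTv ρ (A ⇒ B) = cong suc (cong₂ _+_ (size-renTv ρ A) (size-renTv ρ B))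
size-renTv ρ (∀' A)  = cong suc (size-renTv (ext ρ) A)

size-subTv : ∀ σ → (∀ n → size (σ n) ≡ 1) → ∀ A → size (subTv σ A) ≡ size A
size-subTv σ σ-atomic (tv n)  = σ-atomic n
size-subTv σ σ-atomic (ev n)  = refl
size-subTv σ σ-atomic (A ⇒ B) =
  cong suc (cong₂ _+_ (size-subTv σ σ-atomic A) (size-subTv σ σ-atomic B))
size-subTv σ σ-atomic (∀' A)  = cong suc (size-subTv (extTv σ) extTv-atomic A)
  where
  extTv-atomic : ∀ n → size (extTv σ n) ≡ 1
  extTv-atomic zero    = refl
  extTv-atomic (suc n) = trans (size-renTv suc (σ n)) (σ-atomic n)

tvBelow-renEv : ∀ k ρ A → tvBelow k A → tvBelow k (renEv ρ A)
tvBelow-renEv k ρ (tv n)  n<k       = n<k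
tvBelow-renEv k ρ (ev n)  _         = tt
tvBelow-renEv k ρ (A ⇒ B) (cA , cB) = tvBelow-renEv k ρ A cA , tvBelow-renEv k ρ B cB
tvBelow-renEv k ρ (∀' A)  cA        = tvBelow-renEv (suc k) ρ A cA

tvBelow-renTv : ∀ k k′ ρ → (∀ n → n < k → ρ n < k′) →
                ∀ A → tvBelow k A → tvBelow k′ (renTv ρ A)
tvBelow-renTv k k′ ρ ρ< (tv n)  n<k       = ρ< n n<k
tvBelow-renTv k k′ ρ ρ< (ev n)  _         = tt
tvBelow-renTv k k′ ρ ρ< (A ⇒ B) (cA , cB) =
  tvBelow-renTv k k′ ρ ρ< A cA , tvBelow-renTv k k′ ρ ρ< B cB
tvBelow-renTv k k′ ρ ρ< (∀' A)  cA        =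
  tvBelow-renTv (suc k) (suc k′) (ext ρ) ext< A cA
  where
  ext< : ∀ n → n < suc k → ext ρ n < suc k′
  ext< zero    _         = s≤s z≤n
  ext< (suc n) (s≤s n<k) = s≤s (ρ< n n<k)

tvBelow-subTv : ∀ k k′ σ → (∀ n → n < k → tvBelow k′ (σ n)) →
                ∀ A → tvBelow k A → tvBelow k′ (subTv σ A)
tvBelow-subTv k k′ σ σ< (tv n)  n<k       = σ< n n<k
tvBelow-subTv k k′ σ σ< (ev n)  _         = tt
tvBelow-subTv k k′ σ σ< (A ⇒ B) (cA , cB) =
  tvBelow-subTv k k′ σ σ< A cA , tvBelow-subTv k k′ σ σ< B cB
tvBelow-subTv k k′ σ σ< (∀' A)  cA        =
  tvBelow-subTv (suc k) (suc k′) (extTv σ) extTv< A cA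
  where
  extTv< : ∀ n → n < suc k → tvBelow (suc k′) (extTv σ n)
  extTv< zero    _         = s≤s z≤n
  extTv< (suc n) (s≤s n<k) =
    tvBelow-renTv k′ (suc k′) suc (λ _ → s≤s) (σ n) (σ< n n<k)

-- The body C = A{a:=𝐚} of ∀a.A as produced by rule (8), 𝐚 being the new eigenvariable 0.
instFresh : Ty → Ty
instFresh A = renEv suc A [ ev zero ]ᵀ

size-instFresh : ∀ A → size (instFresh A) ≡ size A
size-instFresh A =
  trans (size-subTv (single (ev zero) tv) atomic (renEv suc A)) (size-renEv suc A)
  where
  atomic : ∀ n → size (single (ev zero) tv n) ≡ 1
  atomic zero    = refl
  atomic (suc _) = refl

TvClosed-instFresh : ∀ A → tvBelow 1 A → TvClosed (instFresh A)
TvClosed-instFresh A cA =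
  tvBelow-subTv 1 0 (single (ev zero) tv) closed (renEv suc A) (tvBelow-renEv 1 suc A cA)
  where
  closed : ∀ n → n < 1 → TvClosed (single (ev zero) tv n)
  closed zero    _         = tt
  closed (suc _) (s≤s ())

ver-gen-⇒ : ∀ A B → ver (A ⇒ B) (gen (A ⇒ B)) ↠w ver B (tri (ver A (gen A)) (gen B))
ver-gen-⇒ A B = ver⇒ ◅ verW (appW gen⇒) ◅ verW β ◅ ε

ver-gen-∀ : ∀ A → ver (∀' A) (gen (∀' A)) ↠w nu (ver (instFresh A) (gen (instFresh A)))
ver-gen-∀ A = verW gen∀ ◅ ver∀ ◅ nuW (verW βT) ◅ ε

_⊏_ : Ty → Ty → Set
_⊏_ = _<_ on size

⊏-wellFounded : WellFounded _⊏_
⊏-wellFounded = wellFounded size <-wellFounded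

ver-gen↠⋆ : ∀ A → Acc _⊏_ A → TvClosed A → ver A (gen A) ↠w star
ver-gen↠⋆ (tv _)  _         ()
ver-gen↠⋆ (ev _)  _         _         = verEv ◅ ε
ver-gen↠⋆ (A ⇒ B) (acc rec) (cA , cB) =
  ver-gen-⇒ A B
  ◅◅ gmap (λ M → ver B (tri M (gen B))) (λ r → verW (triW r))
          (ver-gen↠⋆ A (rec (s≤s (m≤m+n (size A) (size B)))) cA)
  ◅◅ verW tri⋆
  ◅ ver-gen↠⋆ B (rec (s≤s (m≤n+m (size B) (size A)))) cB
ver-gen↠⋆ (∀' A)  (acc rec) cA        =
  ver-gen-∀ A
  ◅◅ gmap nu nuW
          (ver-gen↠⋆ (instFresh A) (rec (s≤s (≤-reflexive (size-instFresh A))))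
                     (TvClosed-instFresh A cA))
  ◅◅ νgc {star} ◅ ε

lemma4p5 : (A : Ty) → TvClosed A → ver A (gen A) ↠w star
lemma4p5 A = ver-gen↠⋆ A (⊏-wellFounded A)
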